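{- Let $\Phi$ and $\Psi$ be the maps defined in the context. Then for every countable linear ordering $L$ (viewed as a structure $(L,<,s,p)$), $\Phi(L)$ is a model of $T$; for every countable model $K$ of $T$, $\Psi(K)$ is a countable linear ordering (viewed as a $(<,s,p)$-structure); and $\Phi$ and $\Psi$ are mutually inverse up to isomorphism, i.e. $\Psi(\Phi(L))\cong L$ and $\Phi(\Psi(K))\cong K$ for all such $L$ and $K$.
   Context: For a linear ordering $L$, $s(x)$ is the immediate successor of $x$ if it exists and $x$ otherwise; $p(x)$ is the immediate predecessor of $x$ if it exists and $x$ otherwise. Write $x\sim_1 y$ if only finitely many elements lie between $x$ and $y$; this is a convex equivalence relation whose classes (1-blocks) are each isomorphic to $\omega$, $\omega^*$ (reverse of $\omega$), $\zeta$ (the integers) or a finite ordering $n\ge 1$, and $L/\sim_1$ is linearly ordered by $[x]<[y]$ iff $x'<y'$ for all $x'\in[x],y'\in[y]$. $T$ is the theory in the language $(<,w,z,sw,\{c_n\}_{n\ge1})$ of unary predicates $w,z,sw,c_n$ (also written $c_{ -2}=w$, $c_{ -1}=z$, $c_0=sw$) with axioms: (1) $<$ is a linear ordering; (2) every element satisfies some $c_n$, $n\ge -2$; (3) no element satisfies two distinct $c_n,c_m$; (4) for $i,j\ge1$: if $x<y$, $c_i(x)$, $c_j(y)$ then some $z$ has $x<z<y$; (5) for $i\ge0$: if $x<y$, $c_i(x)$, $w(y)$ then some $z$ has $x<z<y$; (6) for $i\ge1$: if $x<y$, $sw(x)$, $c_i(y)$ then some $z$ has $x<z<y$; (7) if $x<y$,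 $sw(x)$, $w(y)$ then some $z$ has $x<z<y$. $\Phi(L)$ is the ordering $L/\sim_1$ where a block $[x]$ gets color $w$ if $[x]\cong\omega$, $z$ if $[x]\cong\zeta$, $sw$ if $[x]\cong\omega^*$, and $c_n$ if $[x]\cong n$. For a model $K$ of $T$ and $x\in K$, let $D(x)$ be $n$ if $c_n(x)$ ($n\ge1$), $\omega$ if $w(x)$, $\omega^*$ if $sw(x)$, $\zeta$ if $z(x)$; then $\Psi(K)=\sum_{x\in K}D(x)$ (ordered sum along $K$). -}

module Defs where

open import Level using (0ℓ)
open import Data.Nat as ℕ using (ℕ; zero; suc)
open import Data.Integer as ℤ using (ℤ; +_)
open import Data.Fin as Fin using (Fin)
open import Data.List using (List)
open import Data.List.Relation.Unary.Any using (Any)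
open import Data.Product using (Σ; ∃; ∃-syntax; _×_; _,_; proj₁; proj₂)
open import Data.Sum using (_⊎_)
open import Relation.Binary.PropositionalEquality using (_≡_)
open import Relation.Binary.Structures using (IsStrictTotalOrder)

-- Ordered structures on setoids: a carrier, an equality, and a strict
-- order.  (Quotients do not exist in Agda, so L/~₁ is represented with
-- carrier L and equality ~₁.)  The functions s, p are definable from <,
-- so isomorphisms of (<,s,p)-structures are exactly order isomorphisms.

record OrdStr : Set₁ where
  field
    Carrier : Set
    _≈_     : Carrier → Carrier → Set
    _<_     : Carrier → Carrier → Set

IsLinOrd : OrdStr → Set
IsLinOrd O = IsStrictTotalOrder _≈_ _<_
  where open OrdStr O

Countable : OrdStr → Set
Countable O = Σ (Carrier → ℕ) λ f → ((∀ x y → x ≈ y → f x ≡ f y) × (∀ x y → f x ≡ f y → x ≈ y))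
  where open OrdStr O

record _≅_ (A B : OrdStr) : Set where
  private
    module A = OrdStr A
    module B = OrdStr B
  field
    to       : A.Carrier → B.Carrier
    from     : B.Carrier → A.Carrier
    to-cong  : ∀ {x y} → x A.≈ y → to x B.≈ to y
    from-cong : ∀ {x y} → x B.≈ y → from x A.≈ from y
    from∘to  : ∀ x → from (to x) A.≈ x
    to∘from  : ∀ y → to (from y) B.≈ y
    to-mono  : ∀ {x y} → x A.< y → to x B.< to y
    to-refl  : ∀ {x y} → to x B.< to y → x A.< y

ωO : OrdStr
ωO = record { Carrier = ℕ ; _≈_ = _≡_ ; _<_ = ℕ._<_ }

ω*O : OrdStr
ω*O = record { Carrier = ℕ ; _≈_ = _≡_ ; _<_ = ℕ._>_ }

ζO : OrdStr
ζO = record { Carrier = ℤ ; _≈_ = _≡_ ; _<_ = ℤ._<_ }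

finO : ℕ → OrdStr
finO n = record { Carrier = Fin n ; _≈_ = _≡_ ; _<_ = Fin._<_ }

-- Structures in the language of T.
-- Colours: cw = w (= c_{-2}), cz = z (= c_{-1}), csw = sw (= c_0),
-- cn k = c_{k+1}  (so cn ranges over c_n, n ≥ 1).

data Col : Set where
  cw cz csw : Col
  cn        : ℕ → Col

record TStr : Set₁ where
  field
    ord : OrdStr
  open OrdStr ord public
  field
    P : Col → Carrier → Set

module _ (K : TStr) where
  open TStr K

  Gap : Carrier → Carrier → Set
  Gap x y = ∃[ u ] (x < u × u < y)

  record IsModelT : Set where
    field
      linear   : IsLinOrd ord
      P-resp   : ∀ col {x y} → x ≈ y → P col x → P col y
      ax2      : ∀ x → ∃[ col ] P col x
      ax3      : ∀ col col' x → P col x → P col' x → col ≡ col'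
      ax4      : ∀ i j x y → x < y → P (cn i) x → P (cn j) y → Gap x y
      ax5      : ∀ i x y → x < y → P (cn i) x → P cw y → Gap x y
      -- (5) for i = 0 (c_0 = sw) coincides with (7) below
      -- (6) sw, then c_i (i ≥ 1)
      ax6      : ∀ i x y → x < y → P csw x → P (cn i) y → Gap x y
      ax7      : ∀ x y → x < y → P csw x → P cw y → Gap x y

record _≅ₜ_ (K K' : TStr) : Set where
  field
    iso   : TStr.ord K ≅ TStr.ord K'
  open _≅_ iso
  field
    P-to   : ∀ col x → TStr.P K col x → TStr.P K' col (to x)
    P-from : ∀ col x → TStr.P K' col (to x) → TStr.P K col x

module _ (L : OrdStr) where
  open OrdStr L

  Between : Carrier → Carrier → Carrier → Set
  Between x y u = (x < u × u < y) ⊎ (y < u × u < x)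

  _~₁_ : Carrier → Carrier → Set
  x ~₁ y = ∃[ xs ] (∀ u → Between x y u → Any (u ≈_) xs)

  Block : Carrier → OrdStr
  Block x = record
    { Carrier = Σ Carrier (λ y → x ~₁ y)
    ; _≈_ = λ a b → proj₁ a ≈ proj₁ b
    ; _<_ = λ a b → proj₁ a < proj₁ b }

  _<Φ_ : Carrier → Carrier → Set
  x <Φ y = ∀ x' y' → x ~₁ x' → y ~₁ y' → x' < y'

  ΦCol : Col → Carrier → Set
  ΦCol cw     x = Block x ≅ ωO
  ΦCol cz     x = Block x ≅ ζO
  ΦCol csw    x = Block x ≅ ω*O
  ΦCol (cn k) x = Block x ≅ finO (suc k)

Φ : OrdStr → TStr
Φ L = record
  { ord = record { Carrier = OrdStr.Carrier L ; _≈_ = _~₁_ L ; _<_ = _<Φ_ L }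
  ; P = ΦCol L }

-- Ψ : T-structures → linear orderings  (ordered sum of D(x) along K)
-- D(x) is realised as a set of integers: ω = {i ≥ 0}, ω* = {i < 0},
-- ζ = ℤ, n = {0,…,n-1}, each with the usual order of ℤ.

module _ (K : TStr) where
  open TStr K

  InD : Carrier → ℤ → Set
  InD x i = (P cw x × (+ 0) ℤ.≤ i)
          ⊎ (P cz x)
          ⊎ (P csw x × i ℤ.< (+ 0))
          ⊎ (∃[ k ] (P (cn k) x × (+ 0) ℤ.≤ i × i ℤ.< (+ suc k)))

  ΨCarrier : Set
  ΨCarrier = Σ (Carrier × ℤ) (λ p → InD (proj₁ p) (proj₂ p))

Ψ : TStr → OrdStr
Ψ K = record
  { Carrier = ΨCarrier K
  ; _≈_ = λ a b → (proj₁ (proj₁ a) ≈ proj₁ (proj₁ b)) × (proj₂ (proj₁ a) ≡ proj₂ (proj₁ b))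
  ; _<_ = λ a b → (proj₁ (proj₁ a) < proj₁ (proj₁ b))
                ⊎ ((proj₁ (proj₁ a) ≈ proj₁ (proj₁ b)) × (proj₂ (proj₁ a) ℤ.< proj₂ (proj₁ b))) }
  where open TStr K

{-# OPTIONS --safe #-}
module Submission where

open import Axiom.DoubleNegationElimination using (em⇒dne)
open import Axiom.ExcludedMiddle using (ExcludedMiddle)
open import Data.Bool using (Bool; true; false; T)
open import Data.Empty using (⊥; ⊥-elim)
open import Data.Fin as Fin using (Fin)
import Data.Fin.Properties as FinP
open import Data.Integer as ℤ using (ℤ; +_; -[1+_]; ∣_∣)
import Data.Integer.Properties as ℤP
open import Data.List using (List; []; _∷_; _++_; length; lookup)
open import Data.List.Relation.Unary.Any as Any using (Any; here; there)
import Data.List.Relation.Unary.Any.Properties as AnyP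
open import Data.Nat as ℕ using (ℕ; zero; suc; _+_; z≤n; s≤s)
import Data.Nat.Properties as ℕP
open import Data.Nat.GeneralisedArithmetic using (fold; fold-+)
open import Data.Nat.Induction using (<-rec)
open import Data.Product using (Σ; ∃-syntax; _×_; _,_; proj₁; proj₂)
open import Data.Product.Relation.Binary.Lex.Strict using (×-isStrictTotalOrder)
open import Data.Sum using (_⊎_; inj₁; inj₂)
open import Data.Unit using (⊤; tt)
open import Defs
open import Function.Base using (_∘_; _on_)
open import Level using (0ℓ)
import Relation.Binary.Construct.Flip.EqAndOrd as Flip
import Relation.Binary.Construct.On as On
open import Relation.Binary.Definitions using (Tri; tri<; tri≈; tri>)
open import Relation.Binary.PropositionalEquality
  using (_≡_; refl; sym; trans; cong; cong₂; subst; subst₂; module ≡-Reasoning)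
open import Relation.Binary.Structures using (IsStrictTotalOrder)
open import Relation.Nullary using (¬_; yes; no; T?)

-- Two elements are ~₁-related iff one is reached from the other by finitely many
-- immediate-successor steps (induction on a list covering the interval). Signed step
-- distance from a base point therefore embeds each block into ℤ as an interval, and
-- excluded middle decides which one: whether the block has a least and a greatest
-- element gives ω, ω*, ζ or a finite n. Axioms (4)–(7) say exactly that a block with a
-- greatest element is never immediately followed by a block with a least element, which
-- holds in Φ L since otherwise the two blocks would merge. Conversely, points of Ψ K over
-- x < x′ are infinitely far apart: D(x) is unbounded above, or D(x′) unbounded below, or
-- some point between has no least element, or else the gap axioms yield an infinite
-- descending chain between x and x′; so the blocks of Ψ K are exactly the sets D(x).
-- For Ψ (Φ L) ≅ L each block needs a canonical representative: its element of least
-- code under the injection into ℕ.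

module LinOrd {O : OrdStr} (lin : IsLinOrd O) = IsStrictTotalOrder lin

≅-sym : ∀ {A B} → IsLinOrd B → A ≅ B → B ≅ A
≅-sym linB f = record
  { to = from ; from = to ; to-cong = from-cong ; from-cong = to-cong
  ; from∘to = to∘from ; to∘from = from∘to
  ; to-mono = λ y<y′ → to-refl (<-respˡ-≈ (Eq.sym (to∘from _)) (<-respʳ-≈ (Eq.sym (to∘from _)) y<y′))
  ; to-refl = λ x<x′ → <-respˡ-≈ (to∘from _) (<-respʳ-≈ (to∘from _) (to-mono x<x′)) }
  where open _≅_ f
        open LinOrd linB

≅-trans : ∀ {A B C} → IsLinOrd A → IsLinOrd C → A ≅ B → B ≅ C → A ≅ C
≅-trans linA linC f g = record
  { to = G.to ∘ F.to
  ; from = F.from ∘ G.from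
  ; to-cong = G.to-cong ∘ F.to-cong
  ; from-cong = F.from-cong ∘ G.from-cong
  ; from∘to = λ x → LinOrd.Eq.trans linA (F.from-cong (G.from∘to (F.to x))) (F.from∘to x)
  ; to∘from = λ z → LinOrd.Eq.trans linC (G.to-cong (F.to∘from (G.from z))) (G.to∘from z)
  ; to-mono = G.to-mono ∘ F.to-mono
  ; to-refl = F.to-refl ∘ G.to-refl }
  where module F = _≅_ f
        module G = _≅_ g

HasMin HasMax : OrdStr → Set
HasMin O = ∃[ m ] ∀ y → ¬ y < m
  where open OrdStr O
HasMax O = ∃[ m ] ∀ y → ¬ m < y
  where open OrdStr O

HasMin-resp-≅ : ∀ {A B} → IsLinOrd B → A ≅ B → HasMin A → HasMin B
HasMin-resp-≅ linB f (m , m-min) =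
  to m , λ y y<m → m-min (from y) (to-refl (<-respˡ-≈ (Eq.sym (to∘from y)) y<m))
  where open _≅_ f
        open LinOrd linB

HasMax-resp-≅ : ∀ {A B} → IsLinOrd B → A ≅ B → HasMax A → HasMax B
HasMax-resp-≅ linB f (m , m-max) =
  to m , λ y m<y → m-max (from y) (to-refl (<-respʳ-≈ (Eq.sym (to∘from y)) m<y))
  where open _≅_ f
        open LinOrd linB

finO-injective : ∀ {m n} → finO m ≅ finO n → m ≡ n
finO-injective f = FinP.cantor-schröder-bernstein to-injective from-injective
  where
  open _≅_ f
  to-injective : ∀ {x y} → to x ≡ to y → x ≡ y
  to-injective {x} {y} eq = trans (sym (from∘to x)) (trans (cong from eq) (from∘to y))
  from-injective : ∀ {x y} → from x ≡ from y → x ≡ y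
  from-injective {x} {y} eq = trans (sym (to∘from x)) (trans (cong to eq) (to∘from y))

-- Order types of the colours

ColourCarrier : Col → Set
ColourCarrier cw     = ℕ
ColourCarrier cz     = ℤ
ColourCarrier csw    = ℕ
ColourCarrier (cn k) = Fin (suc k)

colourLt : (c : Col) → ColourCarrier c → ColourCarrier c → Set
colourLt cw     = ℕ._<_
colourLt cz     = ℤ._<_
colourLt csw    = ℕ._>_
colourLt (cn k) = Fin._<_

-- Unfolds to ωO, ζO, ω*O and finO (suc k) on the four kinds of colour, but its
-- equality is _≡_ even for a variable colour c.
orderType : Col → OrdStr
orderType c = record { Carrier = ColourCarrier c ; _≈_ = _≡_ ; _<_ = colourLt c }

orderType-linear : ∀ c → IsLinOrd (orderType c)
orderType-linear cw     = ℕP.<-isStrictTotalOrder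
orderType-linear cz     = ℤP.<-isStrictTotalOrder
orderType-linear csw    = Flip.isStrictTotalOrder ℕP.<-isStrictTotalOrder
orderType-linear (cn k) = FinP.<-isStrictTotalOrder

hasMin hasMax : Col → Bool
hasMin cw     = true
hasMin cz     = false
hasMin csw    = false
hasMin (cn _) = true
hasMax cw     = false
hasMax cz     = false
hasMax csw    = true
hasMax (cn _) = true

hasMin⇒HasMin : ∀ c → T (hasMin c) → HasMin (orderType c)
hasMin⇒HasMin cw     _ = 0 , λ _ ()
hasMin⇒HasMin (cn k) _ = Fin.zero , λ _ ()

HasMin⇒hasMin : ∀ c → HasMin (orderType c) → T (hasMin c)
HasMin⇒hasMin cw     _             = tt
HasMin⇒hasMin cz     (m , m-min)   = m-min (ℤ.pred m) (ℤP.i≤pred[j]⇒i<j ℤP.≤-refl)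
HasMin⇒hasMin csw    (m , m-min)   = m-min (suc m) (ℕP.n<1+n m)
HasMin⇒hasMin (cn k) _             = tt

hasMax⇒HasMax : ∀ c → T (hasMax c) → HasMax (orderType c)
hasMax⇒HasMax csw    _ = 0 , λ _ ()
hasMax⇒HasMax (cn k) _ = Fin.fromℕ k , λ y k<y → ℕP.<⇒≱ k<y (FinP.≤fromℕ y)

HasMax⇒hasMax : ∀ c → HasMax (orderType c) → T (hasMax c)
HasMax⇒hasMax cw     (m , m-max) = m-max (suc m) (ℕP.n<1+n m)
HasMax⇒hasMax cz     (m , m-max) = m-max (ℤ.suc m) (ℤP.suc[i]≤j⇒i<j ℤP.≤-refl)
HasMax⇒hasMax csw    _           = tt
HasMax⇒hasMax (cn k) _           = tt

T-injective : ∀ {a b} → (T a → T b) → (T b → T a) → a ≡ b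
T-injective {false} {false} _ _ = refl
T-injective {false} {true}  _ g = ⊥-elim (g tt)
T-injective {true}  {false} f _ = ⊥-elim (f tt)
T-injective {true}  {true}  _ _ = refl

module _ {c c′ : Col} (f : orderType c ≅ orderType c′) where
  private
    f⁻¹ = ≅-sym (orderType-linear c′) f

  hasMin-resp-≅ : hasMin c ≡ hasMin c′
  hasMin-resp-≅ = T-injective
    (HasMin⇒hasMin c′ ∘ HasMin-resp-≅ (orderType-linear c′) f ∘ hasMin⇒HasMin c)
    (HasMin⇒hasMin c ∘ HasMin-resp-≅ (orderType-linear c) f⁻¹ ∘ hasMin⇒HasMin c′)

  hasMax-resp-≅ : hasMax c ≡ hasMax c′
  hasMax-resp-≅ = T-injective
    (HasMax⇒hasMax c′ ∘ HasMax-resp-≅ (orderType-linear c′) f ∘ hasMax⇒HasMax c)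
    (HasMax⇒hasMax c ∘ HasMax-resp-≅ (orderType-linear c) f⁻¹ ∘ hasMax⇒HasMax c′)

orderType-injective : ∀ {c c′} → orderType c ≅ orderType c′ → c ≡ c′
orderType-injective {c} {c′} f = ends-determine c c′ (hasMin-resp-≅ f) (hasMax-resp-≅ f) f
  where
  ends-determine : ∀ c c′ → hasMin c ≡ hasMin c′ → hasMax c ≡ hasMax c′ →
                   orderType c ≅ orderType c′ → c ≡ c′
  ends-determine cw     cw      _  _  _ = refl
  ends-determine cz     cz      _  _  _ = refl
  ends-determine csw    csw     _  _  _ = refl
  ends-determine (cn k) (cn k′) _  _  f = cong cn (ℕP.suc-injective (finO-injective f))
  ends-determine cw     cz      () _  _
  ends-determine cw     csw     () _  _
  ends-determine cw     (cn _)  _  () _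
  ends-determine cz     cw      () _  _
  ends-determine cz     csw     _  () _
  ends-determine cz     (cn _)  () _  _
  ends-determine csw    cw      () _  _
  ends-determine csw    cz      _  () _
  ends-determine csw    (cn _)  () _  _
  ends-determine (cn _) cw      _  () _
  ends-determine (cn _) cz      () _  _
  ends-determine (cn _) csw     () _  _

ℤ-suborder : (ℤ → Set) → OrdStr
ℤ-suborder S = record { Carrier = Σ ℤ S ; _≈_ = _≡_ on proj₁ ; _<_ = ℤ._<_ on proj₁ }

ℤ-suborder-linear : ∀ S → IsLinOrd (ℤ-suborder S)
ℤ-suborder-linear S = On.isStrictTotalOrder proj₁ ℤP.<-isStrictTotalOrder

ℤ-suborder-cong : ∀ {S S′ : ℤ → Set} → (∀ {i} → S i → S′ i) → (∀ {i} → S′ i → S i) →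
                  ℤ-suborder S ≅ ℤ-suborder S′
ℤ-suborder-cong S⇒S′ S′⇒S = record
  { to = λ (i , s) → i , S⇒S′ s ; from = λ (i , s) → i , S′⇒S s
  ; to-cong = λ eq → eq ; from-cong = λ eq → eq
  ; from∘to = λ _ → refl ; to∘from = λ _ → refl
  ; to-mono = λ lt → lt ; to-refl = λ lt → lt }

ℤ-suborder-shift : ∀ S → ℤ-suborder (S ∘ ℤ.suc) ≅ ℤ-suborder S
ℤ-suborder-shift S = record
  { to = λ (i , s) → ℤ.suc i , s
  ; from = λ (j , s) → ℤ.pred j , subst S (sym (ℤP.suc-pred j)) s
  ; to-cong = cong ℤ.suc ; from-cong = cong ℤ.pred
  ; from∘to = λ (i , _) → ℤP.pred-suc i
  ; to∘from = λ (j , _) → ℤP.suc-pred j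
  ; to-mono = ℤP.+-monoʳ-< (+ 1)
  ; to-refl = λ {(i , _)} {(j , _)} lt →
      subst₂ ℤ._<_ (ℤP.pred-suc i) (ℤP.pred-suc j) (ℤP.+-monoʳ-< -[1+ 0 ] lt) }

InColour : Col → ℤ → Set
InColour cw     i = + 0 ℤ.≤ i
InColour cz     _ = ⊤
InColour csw    i = i ℤ.< + 0
InColour (cn k) i = + 0 ℤ.≤ i × i ℤ.< + suc k

embed : ∀ c → ColourCarrier c → ℤ
embed cw     n = + n
embed cz     i = i
embed csw    n = -[1+ n ]
embed (cn k) j = + Fin.toℕ j

embed-InColour : ∀ c t → InColour c (embed c t)
embed-InColour cw     _ = ℤ.+≤+ z≤n
embed-InColour cz     _ = tt
embed-InColour csw    _ = ℤ.-<+
embed-InColour (cn k) j = ℤ.+≤+ z≤n , ℤ.+<+ (FinP.toℕ<n j)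

embed-mono : ∀ c {t t′} → colourLt c t t′ → embed c t ℤ.< embed c t′
embed-mono cw     lt = ℤ.+<+ lt
embed-mono cz     lt = lt
embed-mono csw    lt = ℤ.-<- lt
embed-mono (cn k) lt = ℤ.+<+ lt

embed-reflects : ∀ c {t t′} → embed c t ℤ.< embed c t′ → colourLt c t t′
embed-reflects cw     (ℤ.+<+ lt) = lt
embed-reflects cz     lt         = lt
embed-reflects csw    (ℤ.-<- lt) = lt
embed-reflects (cn k) (ℤ.+<+ lt) = lt

retract : ∀ c {i} → InColour c i → ColourCarrier c
retract cw     {+ n}      _                = n
retract cz     {i}        _                = i
retract csw    { -[1+ n ]} _               = n
retract (cn k) {+ n}      (_ , ℤ.+<+ n<k) = Fin.fromℕ< n<k
retract cw     { -[1+ _ ]} ()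
retract csw    {+ _}      (ℤ.+<+ ())
retract (cn k) { -[1+ _ ]} (() , _)

retract-cong : ∀ c {i} (s s′ : InColour c i) → retract c s ≡ retract c s′
retract-cong cw     {+ _}      _              _              = refl
retract-cong cz     _          _                             = refl
retract-cong csw    { -[1+ _ ]} _             _              = refl
retract-cong (cn k) {+ _}      (_ , ℤ.+<+ _) (_ , ℤ.+<+ _) = refl
retract-cong cw     { -[1+ _ ]} ()
retract-cong csw    {+ _}      (ℤ.+<+ ())
retract-cong (cn k) { -[1+ _ ]} (() , _)

embed-retract : ∀ c {i} (s : InColour c i) → embed c (retract c s) ≡ i
embed-retract cw     {+ _}      _              = refl
embed-retract cz     _                         = refl
embed-retract csw    { -[1+ _ ]} _             = refl
embed-retract (cn k) {+ _}      (_ , ℤ.+<+ _) = cong +_ (FinP.toℕ-fromℕ< _)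
embed-retract cw     { -[1+ _ ]} ()
embed-retract csw    {+ _}      (ℤ.+<+ ())
embed-retract (cn k) { -[1+ _ ]} (() , _)

retract-embed : ∀ c t → retract c (embed-InColour c t) ≡ t
retract-embed cw     _ = refl
retract-embed cz     _ = refl
retract-embed csw    _ = refl
retract-embed (cn k) j = FinP.fromℕ<-toℕ j _

InColour≅orderType : ∀ c → ℤ-suborder (InColour c) ≅ orderType c
InColour≅orderType c = record
  { to = λ (_ , s) → retract c s
  ; from = λ t → embed c t , embed-InColour c t
  ; to-cong = λ { {_ , s} {_ , s′} refl → retract-cong c s s′ }
  ; from-cong = cong (embed c)
  ; from∘to = λ (_ , s) → embed-retract c s
  ; to∘from = retract-embed c
  ; to-mono = λ { {_ , s} {_ , s′} i<j →
      embed-reflects c (subst₂ ℤ._<_ (sym (embed-retract c s)) (sym (embed-retract c s′)) i<j) }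
  ; to-refl = λ { {_ , s} {_ , s′} t<t′ →
      subst₂ ℤ._<_ (embed-retract c s) (embed-retract c s′) (embed-mono c t<t′) } }

InColour-unbounded↑ : ∀ c → ¬ T (hasMax c) → ∀ n → InColour c (+ n)
InColour-unbounded↑ cw     _      _ = ℤ.+≤+ z≤n
InColour-unbounded↑ cz     _      _ = tt
InColour-unbounded↑ csw    no-max _ = ⊥-elim (no-max tt)
InColour-unbounded↑ (cn _) no-max _ = ⊥-elim (no-max tt)

InColour-unbounded↓ : ∀ c → ¬ T (hasMin c) → ∀ n → InColour c -[1+ n ]
InColour-unbounded↓ cw     no-min _ = ⊥-elim (no-min tt)
InColour-unbounded↓ cz     _      _ = tt
InColour-unbounded↓ csw    _      _ = ℤ.-<+
InColour-unbounded↓ (cn _) no-min _ = ⊥-elim (no-min tt)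

anchor : Col → ℤ
anchor csw = -[1+ 0 ]
anchor _   = + 0

anchor-InColour : ∀ c → InColour c (anchor c)
anchor-InColour cw     = ℤ.+≤+ z≤n
anchor-InColour cz     = tt
anchor-InColour csw    = ℤ.-<+
anchor-InColour (cn _) = ℤ.+≤+ z≤n , ℤ.+<+ (s≤s z≤n)

-- Cantor's enumeration of ℕ × ℕ, diagonal by diagonal.
nextPair : ℕ × ℕ → ℕ × ℕ
nextPair (a , zero)  = zero , suc a
nextPair (a , suc b) = suc a , b

unpair : ℕ → ℕ × ℕ
unpair = fold (0 , 0) nextPair

triangle : ℕ → ℕ
triangle zero    = 0
triangle (suc s) = suc s + triangle s

pair : ℕ → ℕ → ℕ
pair a b = a + triangle (a + b)

fold-nextPair-diagonal : ∀ k a b → fold (a , k + b) nextPair k ≡ (k + a , b)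
fold-nextPair-diagonal zero    a b = refl
fold-nextPair-diagonal (suc k) a b = begin
  nextPair (fold (a , suc k + b) nextPair k) ≡⟨ cong (λ m → nextPair (fold (a , m) nextPair k)) (sym (ℕP.+-suc k b)) ⟩
  nextPair (fold (a , k + suc b) nextPair k) ≡⟨ cong nextPair (fold-nextPair-diagonal k a (suc b)) ⟩
  suc k + a , b                              ∎
  where open ≡-Reasoning

unpair-triangle : ∀ s → unpair (triangle s) ≡ (0 , s)
unpair-triangle zero    = refl
unpair-triangle (suc s) = begin
  unpair (suc s + triangle s)                 ≡⟨ fold-+ (0 , 0) nextPair (suc s) ⟩
  fold (unpair (triangle s)) nextPair (suc s) ≡⟨ cong (λ p → fold p nextPair (suc s)) (unpair-triangle s) ⟩
  nextPair (fold (0 , s) nextPair s)          ≡⟨ cong (λ m → nextPair (fold (0 , m) nextPair s)) (sym (ℕP.+-identityʳ s)) ⟩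
  nextPair (fold (0 , s + 0) nextPair s)      ≡⟨ cong nextPair (fold-nextPair-diagonal s 0 0) ⟩
  nextPair (s + 0 , 0)                        ≡⟨ cong (λ m → nextPair (m , 0)) (ℕP.+-identityʳ s) ⟩
  0 , suc s                                   ∎
  where open ≡-Reasoning

unpair-pair : ∀ a b → unpair (pair a b) ≡ (a , b)
unpair-pair a b = begin
  unpair (a + triangle (a + b))              ≡⟨ fold-+ (0 , 0) nextPair a ⟩
  fold (unpair (triangle (a + b))) nextPair a ≡⟨ cong (λ p → fold p nextPair a) (unpair-triangle (a + b)) ⟩
  fold (0 , a + b) nextPair a                ≡⟨ fold-nextPair-diagonal a 0 b ⟩
  a + 0 , b                                  ≡⟨ cong (_, b) (ℕP.+-identityʳ a) ⟩
  a , b                                      ∎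
  where open ≡-Reasoning

pair-injective : ∀ {a b c d} → pair a b ≡ pair c d → a ≡ c × b ≡ d
pair-injective {a} {b} {c} {d} eq
  with refl ← trans (sym (unpair-pair a b)) (trans (cong unpair eq) (unpair-pair c d)) = refl , refl

encodeℤ : ℤ → ℕ
encodeℤ (+ n)      = pair 0 n
encodeℤ -[1+ n ]   = pair 1 n

encodeℤ-injective : ∀ {i j} → encodeℤ i ≡ encodeℤ j → i ≡ j
encodeℤ-injective {+ m}      {+ n}      eq = cong +_ (proj₂ (pair-injective {0} {m} {0} {n} eq))
encodeℤ-injective { -[1+ m ]} { -[1+ n ]} eq = cong -[1+_] (proj₂ (pair-injective {1} {m} {1} {n} eq))
encodeℤ-injective {+ m}      { -[1+ n ]} eq with () ← proj₁ (pair-injective {0} {m} {1} {n} eq)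
encodeℤ-injective { -[1+ m ]} {+ n}      eq with () ← proj₁ (pair-injective {1} {m} {0} {n} eq)

-- Finite condensation

module Condensation {L : OrdStr} (lin : IsLinOrd L) where

  open OrdStr L
  open LinOrd lin renaming (trans to <-trans)

  infix 4 _~_
  _~_ : Carrier → Carrier → Set
  _~_ = _~₁_ L

  ~-refl : ∀ {x} → x ~ x
  ~-refl = [] , λ { _ (inj₁ (x<u , u<x)) → ⊥-elim (asym x<u u<x)
                  ; _ (inj₂ (x<u , u<x)) → ⊥-elim (asym x<u u<x) }

  ~-sym : ∀ {x y} → x ~ y → y ~ x
  ~-sym (xs , cover) = xs , λ { u (inj₁ between) → cover u (inj₂ between)
                              ; u (inj₂ between) → cover u (inj₁ between) }

  ≈⇒~ : ∀ {x y} → x ≈ y → x ~ y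
  ≈⇒~ x≈y = [] , λ { _ (inj₁ (x<u , u<y)) → ⊥-elim (asym x<u (<-respʳ-≈ (Eq.sym x≈y) u<y))
                   ; _ (inj₂ (y<u , u<x)) → ⊥-elim (asym y<u (<-respʳ-≈ x≈y u<x)) }

  ~-trans : ∀ {x y z} → x ~ y → y ~ z → x ~ z
  ~-trans {x} {y} {z} (xs , coverˣʸ) (ys , coverʸᶻ) = y ∷ xs ++ ys , cover
    where
    cover : ∀ u → Between L x z u → Any (u ≈_) (y ∷ xs ++ ys)
    cover u between with compare u y
    ... | tri≈ _ u≈y _ = here u≈y
    cover u (inj₁ (x<u , _))   | tri< u<y _ _ = there (AnyP.++⁺ˡ (coverˣʸ u (inj₁ (x<u , u<y))))
    cover u (inj₂ (z<u , _))   | tri< u<y _ _ = there (AnyP.++⁺ʳ xs (coverʸᶻ u (inj₂ (z<u , u<y))))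
    cover u (inj₁ (_ , u<z))   | tri> _ _ y<u = there (AnyP.++⁺ʳ xs (coverʸᶻ u (inj₁ (y<u , u<z))))
    cover u (inj₂ (_ , u<x))   | tri> _ _ y<u = there (AnyP.++⁺ˡ (coverˣʸ u (inj₂ (y<u , u<x))))

  ~-convexˡ : ∀ {x y z} → x < y → y < z → x ~ z → x ~ y
  ~-convexˡ x<y y<z (xs , cover) =
    xs , λ { u (inj₁ (x<u , u<y)) → cover u (inj₁ (x<u , <-trans u<y y<z))
           ; u (inj₂ (y<u , u<x)) → ⊥-elim (asym x<y (<-trans y<u u<x)) }

  ~-convexʳ : ∀ {x y z} → x < y → y < z → x ~ z → y ~ z
  ~-convexʳ x<y y<z (xs , cover) =
    xs , λ { u (inj₁ (y<u , u<z)) → cover u (inj₁ (<-trans x<y y<u , u<z))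
           ; u (inj₂ (z<u , u<y)) → ⊥-elim (asym y<z (<-trans z<u u<y)) }

  Cover : Carrier → Carrier → List Carrier → Set
  Cover y z xs = ∀ u → y < u → u < z → Any (u ≈_) xs

  ~⇒Cover : ∀ {y z} (y~z : y ~ z) → Cover y z (proj₁ y~z)
  ~⇒Cover (_ , cover) u y<u u<z = cover u (inj₁ (y<u , u<z))

  injection⇒¬list-cover : (g : ℕ → Carrier) → (∀ m n → g m ≈ g n → m ≡ n) →
                          ∀ xs → ¬ (∀ n → Any (g n ≈_) xs)
  injection⇒¬list-cover g g-injective xs covered
    with i , j , i<j , same-index ← FinP.pigeonhole (ℕP.n<1+n (length xs)) (Any.index ∘ covered ∘ Fin.toℕ)
    = ℕP.<-irrefl (g-injective _ _ gᵢ≈gⱼ) i<j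
    where
    gᵢ≈gⱼ : g (Fin.toℕ i) ≈ g (Fin.toℕ j)
    gᵢ≈gⱼ = Eq.trans (AnyP.lookup-index (covered (Fin.toℕ i)))
              (subst (λ k → lookup xs k ≈ g (Fin.toℕ j)) (sym same-index)
                (Eq.sym (AnyP.lookup-index (covered (Fin.toℕ j)))))

  ~⇒¬injection-between : ∀ {y z} → y ~ z → (g : ℕ → Carrier) → (∀ m n → g m ≈ g n → m ≡ n) →
                          ¬ (∀ n → y < g n × g n < z)
  ~⇒¬injection-between y~z g g-injective between =
    injection⇒¬list-cover g g-injective (proj₁ y~z) λ n → ~⇒Cover y~z (g n) (proj₁ (between n)) (proj₂ (between n))

  decreasing⇒antitone : (g : ℕ → Carrier) → (∀ n → g (suc n) < g n) → ∀ {m n} → m ℕ.< n → g n < g m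
  decreasing⇒antitone g decreasing {m} {suc n} m<1+n with ℕP.m≤n⇒m<n∨m≡n (ℕ.s≤s⁻¹ m<1+n)
  ... | inj₁ m<n  = <-trans (decreasing n) (decreasing⇒antitone g decreasing m<n)
  ... | inj₂ refl = decreasing n

  decreasing⇒injective : (g : ℕ → Carrier) → (∀ n → g (suc n) < g n) → ∀ m n → g m ≈ g n → m ≡ n
  decreasing⇒injective g decreasing m n gₘ≈gₙ with ℕP.<-cmp m n
  ... | tri< m<n _ _ = ⊥-elim (irrefl (Eq.sym gₘ≈gₙ) (decreasing⇒antitone g decreasing m<n))
  ... | tri≈ _ m≡n _ = m≡n
  ... | tri> _ _ n<m = ⊥-elim (irrefl gₘ≈gₙ (decreasing⇒antitone g decreasing n<m))

  descending-chain : ∀ {x y} → ∃[ v ] x < v × v < y → (∀ u → x < u → u < y → ∃[ v ] x < v × v < u) →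
                     ∃[ g ] (∀ n → x < g n × g n < y) × (∀ n → g (suc n) < g n)
  descending-chain {x} {y} start dense = proj₁ ∘ chain , proj₂ ∘ chain , step-< ∘ chain
    where
    step : ∃[ u ] x < u × u < y → ∃[ u ] x < u × u < y
    step (u , x<u , u<y) = let v , x<v , v<u = dense u x<u u<y in v , x<v , <-trans v<u u<y
    step-< : ∀ s → proj₁ (step s) < proj₁ s
    step-< (u , x<u , u<y) = proj₂ (proj₂ (dense u x<u u<y))
    chain : ℕ → ∃[ u ] x < u × u < y
    chain zero    = start
    chain (suc n) = step (chain n)

  Step : Carrier → Carrier → Set
  Step y z = y < z × (∀ u → y < u → ¬ u < z)

  Path : ℕ → Carrier → Carrier → Set
  Path zero    y z = y ≈ z
  Path (suc n) y z = ∃[ w ] Step y w × Path n w z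

  step-unique : ∀ {y w w′} → Step y w → Step y w′ → w ≈ w′
  step-unique {w = w} {w′} (y<w , w-next) (y<w′ , w′-next) with compare w w′
  ... | tri< w<w′ _ _ = ⊥-elim (w′-next w y<w w<w′)
  ... | tri≈ _ w≈w′ _ = w≈w′
  ... | tri> _ _ w′<w = ⊥-elim (w-next w′ y<w′ w′<w)

  step-uniqueˡ : ∀ {y y′ w} → Step y w → Step y′ w → y ≈ y′
  step-uniqueˡ {y} {y′} (y<w , y-prev) (y′<w , y′-prev) with compare y y′
  ... | tri< y<y′ _ _ = ⊥-elim (y-prev y′ y<y′ y′<w)
  ... | tri≈ _ y≈y′ _ = y≈y′
  ... | tri> _ _ y′<y = ⊥-elim (y′-prev y y′<y y<w)

  path-respˡ : ∀ n {y y′ z} → y ≈ y′ → Path n y z → Path n y′ z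
  path-respˡ zero    y≈y′ y≈z                      = Eq.trans (Eq.sym y≈y′) y≈z
  path-respˡ (suc n) y≈y′ (w , (y<w , w-next) , p) =
    w , (<-respˡ-≈ y≈y′ y<w , λ u y′<u → w-next u (<-respˡ-≈ (Eq.sym y≈y′) y′<u)) , p

  path-respʳ : ∀ n {y z z′} → z ≈ z′ → Path n y z → Path n y z′
  path-respʳ zero    z≈z′ y≈z         = Eq.trans y≈z z≈z′
  path-respʳ (suc n) z≈z′ (w , s , p) = w , s , path-respʳ n z≈z′ p

  path-< : ∀ n {y z} → Path (suc n) y z → y < z
  path-< zero    (w , (y<w , _) , w≈z) = <-respʳ-≈ w≈z y<w
  path-< (suc n) (w , (y<w , _) , p)   = <-trans y<w (path-< n p)

  path-≮ : ∀ n {y z} → Path n y z → ¬ z < y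
  path-≮ zero    y≈z = irrefl (Eq.sym y≈z)
  path-≮ (suc n) p   = asym (path-< n p)

  path-<-trans : ∀ n {y z w} → Path n y z → w < y → w < z
  path-<-trans zero    y≈z w<y = <-respʳ-≈ y≈z w<y
  path-<-trans (suc n) p   w<y = <-trans w<y (path-< n p)

  path-++ : ∀ m {n x y z} → Path m x y → Path n y z → Path (m + n) x z
  path-++ zero    {n} x≈y         q = path-respˡ n (Eq.sym x≈y) q
  path-++ (suc m)     (w , s , p) q = w , s , path-++ m p q

  path-split : ∀ m {n x z} → Path (m + n) x z → ∃[ y ] Path m x y × Path n y z
  path-split zero    {x = x} p = x , Eq.refl , p
  path-split (suc m) (w , s , p) =
    let y , p₁ , p₂ = path-split m p in y , (w , s , p₁) , p₂

  path-length-unique : ∀ m n {y z} → Path m y z → Path n y z → m ≡ n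
  path-length-unique zero    zero    _           _             = refl
  path-length-unique zero    (suc n) y≈z         q             = ⊥-elim (irrefl y≈z (path-< n q))
  path-length-unique (suc m) zero    p           y≈z           = ⊥-elim (irrefl y≈z (path-< m p))
  path-length-unique (suc m) (suc n) (w , s , p) (w′ , s′ , q) =
    cong suc (path-length-unique m n p (path-respˡ n (Eq.sym (step-unique s s′)) q))

  path-target-unique : ∀ n {y z z′} → Path n y z → Path n y z′ → z ≈ z′
  path-target-unique zero    y≈z         y≈z′          = Eq.trans (Eq.sym y≈z) y≈z′
  path-target-unique (suc n) (w , s , p) (w′ , s′ , q) =
    path-target-unique n p (path-respˡ n (Eq.sym (step-unique s s′)) q)

  path-source-unique : ∀ n {y y′ z} → Path n y z → Path n y′ z → y ≈ y′
  path-source-unique zero    y≈z         y′≈z          = Eq.trans y≈z (Eq.sym y′≈z)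
  path-source-unique (suc n) (w , s , p) (w′ , (y′<w′ , w′-next) , q) =
    step-uniqueˡ s (<-respʳ-≈ w′≈w y′<w′ , λ u y′<u u<w → w′-next u y′<u (<-respʳ-≈ (Eq.sym w′≈w) u<w))
    where w′≈w = Eq.sym (path-source-unique n p q)

  path⇒~ : ∀ n {y z} → Path n y z → y ~ z
  path⇒~ zero    y≈z                       = ≈⇒~ y≈z
  path⇒~ (suc n) (w , (y<w , w-next) , p) = ~-trans y~w (path⇒~ n p)
    where
    y~w : _ ~ w
    y~w = [] , λ { u (inj₁ (y<u , u<w)) → ⊥-elim (w-next u y<u u<w)
                 ; u (inj₂ (w<u , u<y)) → ⊥-elim (asym y<w (<-trans w<u u<y)) }

  -- Induction on the covering list: its head either splits the interval or can be dropped.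
  Cover⇒path : ∀ xs {y z} → y < z → Cover y z xs → ∃[ n ] Path (suc n) y z
  Cover⇒path []       {z = z} y<z cover =
    0 , z , (y<z , λ u y<u u<z → AnyP.¬Any[] (cover u y<u u<z)) , Eq.refl
  Cover⇒path (x ∷ xs) {y} {z} y<z cover with y <? x | x <? z
  ... | yes y<x | yes x<z =
    let m , p = Cover⇒path xs y<x λ u y<u u<x →
                  Any.tail (λ u≈x → irrefl u≈x u<x) (cover u y<u (<-trans u<x x<z))
        n , q = Cover⇒path xs x<z λ u x<u u<z →
                  Any.tail (λ u≈x → irrefl (Eq.sym u≈x) x<u) (cover u (<-trans y<x x<u) u<z)
    in m + suc n , path-++ (suc m) p q
  ... | no y≮x | _ = Cover⇒path xs y<z λ u y<u u<z →
    Any.tail (λ u≈x → y≮x (<-respʳ-≈ u≈x y<u)) (cover u y<u u<z)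
  ... | _ | no x≮z = Cover⇒path xs y<z λ u y<u u<z →
    Any.tail (λ u≈x → x≮z (<-respˡ-≈ u≈x u<z)) (cover u y<u u<z)

  Pos : Carrier → Carrier → ℤ → Set
  Pos b y (+ n)    = Path n b y
  Pos b y -[1+ n ] = Path (suc n) y b

  Occupied : Carrier → ℤ → Set
  Occupied b k = ∃[ y ] Pos b y k

  pos-total : ∀ {b y} → b ~ y → ∃[ k ] Pos b y k
  pos-total {b} {y} b~y with compare b y
  ... | tri< b<y _ _ = let n , p = Cover⇒path _ b<y (~⇒Cover b~y) in + suc n , p
  ... | tri≈ _ b≈y _ = + 0 , b≈y
  ... | tri> _ _ y<b = let n , p = Cover⇒path _ y<b (~⇒Cover (~-sym b~y)) in -[1+ n ] , p

  pos-respʳ : ∀ {b y y′} k → y ≈ y′ → Pos b y k → Pos b y′ k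
  pos-respʳ (+ n)      = path-respʳ n
  pos-respʳ -[1+ n ]   = path-respˡ (suc n)

  pos⇒~ : ∀ {b y} k → Pos b y k → b ~ y
  pos⇒~ (+ n)      p = path⇒~ n p
  pos⇒~ -[1+ n ]   p = ~-sym (path⇒~ (suc n) p)

  pos-unique : ∀ {b y} k k′ → Pos b y k → Pos b y k′ → k ≡ k′
  pos-unique (+ m)      (+ n)      p q = cong +_ (path-length-unique m n p q)
  pos-unique (+ m)      -[1+ n ]   p q = ⊥-elim (path-≮ m p (path-< n q))
  pos-unique -[1+ m ]   (+ n)      p q = ⊥-elim (path-≮ n q (path-< m p))
  pos-unique -[1+ m ]   -[1+ n ]   p q = cong -[1+_] (ℕP.suc-injective (path-length-unique (suc m) (suc n) p q))

  pos-injective : ∀ {b y y′} k → Pos b y k → Pos b y′ k → y ≈ y′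
  pos-injective (+ n)      = path-target-unique n
  pos-injective -[1+ n ]   = path-source-unique (suc n)

  private
    path-mono : ∀ m n {b y y′} → m ℕ.< n → Path m b y → Path n b y′ → y < y′
    path-mono m n {b} {y′ = y′} m<n p q =
      let y″ , p′ , q′ = path-split m (subst (λ k → Path k b y′) (sym m+[1+d]≡n) q)
      in <-respˡ-≈ (path-target-unique m p′ p) (path-< d q′)
      where
      d = n ℕ.∸ suc m
      m+[1+d]≡n : m + suc d ≡ n
      m+[1+d]≡n = trans (ℕP.+-suc m d) (ℕP.m+[n∸m]≡n m<n)

    path-mono⁻ : ∀ m n {b y y′} → m ℕ.< n → Path (suc m) y′ b → Path (suc n) y b → y < y′
    path-mono⁻ m n {b} {y} m<n p q =
      let y″ , q₁ , q₂ = path-split (suc d) (subst (λ k → Path k y b) (sym [1+d]+[1+m]≡1+n) q)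
      in <-respʳ-≈ (path-source-unique (suc m) q₂ p) (path-< d q₁)
      where
      d = n ℕ.∸ suc m
      [1+d]+[1+m]≡1+n : suc d + suc m ≡ suc n
      [1+d]+[1+m]≡1+n = cong suc (trans (ℕP.+-comm d (suc m)) (ℕP.m+[n∸m]≡n m<n))

  pos-mono : ∀ {b y y′} k k′ → Pos b y k → Pos b y′ k′ → k ℤ.< k′ → y < y′
  pos-mono (+ m)      (+ n)      p q (ℤ.+<+ m<n) = path-mono m n m<n p q
  pos-mono -[1+ m ]   (+ n)      p q ℤ.-<+       = path-<-trans n q (path-< m p)
  pos-mono -[1+ m ]   -[1+ n ]   p q (ℤ.-<- n<m) = path-mono⁻ n m n<m q p

  pos-reflects : ∀ {b y y′} k k′ → Pos b y k → Pos b y′ k′ → y < y′ → k ℤ.< k′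
  pos-reflects k k′ p q y<y′ with ℤP.<-cmp k k′
  ... | tri< k<k′ _ _ = k<k′
  ... | tri≈ _ refl _ = ⊥-elim (irrefl (pos-injective k p q) y<y′)
  ... | tri> _ _ k′<k = ⊥-elim (asym y<y′ (pos-mono k′ k q p k′<k))

  occupied-↓⁺ : ∀ {b m n} → Occupied b (+ n) → m ℕ.≤ n → Occupied b (+ m)
  occupied-↓⁺ {b} {m} (y , p) m≤n =
    let z , p₁ , _ = path-split m (subst (λ k → Path k b y) (sym (ℕP.m+[n∸m]≡n m≤n)) p) in z , p₁

  occupied-↓⁻ : ∀ {b m n} → Occupied b -[1+ n ] → m ℕ.≤ n → Occupied b -[1+ m ]
  occupied-↓⁻ {b} {m} {n} (y , p) m≤n =
    let z , _ , p₂ = path-split (n ℕ.∸ m) (subst (λ k → Path k y b) (sym [n-m]+[1+m]≡1+n) p) in z , p₂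
    where
    [n-m]+[1+m]≡1+n : n ℕ.∸ m + suc m ≡ suc n
    [n-m]+[1+m]≡1+n = trans (ℕP.+-suc (n ℕ.∸ m) m) (cong suc (ℕP.m∸n+n≡m m≤n))

  Block-linear : ∀ b → IsLinOrd (Block L b)
  Block-linear b = On.isStrictTotalOrder proj₁ lin

  Block≅Occupied : ∀ b → Block L b ≅ ℤ-suborder (Occupied b)
  Block≅Occupied b = record
    { to = λ (y , b~y) → let k , p = pos-total b~y in k , y , p
    ; from = λ (k , y , p) → y , pos⇒~ k p
    ; to-cong = λ { {_ , b~y} {_ , b~y′} y≈y′ →
        let k , p = pos-total b~y ; k′ , p′ = pos-total b~y′ in pos-unique k k′ (pos-respʳ k y≈y′ p) p′ }
    ; from-cong = λ { {k , _ , p} {_ , _ , p′} refl → pos-injective k p p′ }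
    ; from∘to = λ _ → Eq.refl
    ; to∘from = λ (k , _ , p) → pos-unique _ k (proj₂ (pos-total (pos⇒~ k p))) p
    ; to-mono = λ { {_ , b~y} {_ , b~y′} y<y′ →
        let k , p = pos-total b~y ; k′ , p′ = pos-total b~y′ in pos-reflects k k′ p p′ y<y′ }
    ; to-refl = λ { {_ , b~y} {_ , b~y′} k<k′ →
        let k , p = pos-total b~y ; k′ , p′ = pos-total b~y′ in pos-mono k k′ p p′ k<k′ } }

  Block-resp-~ : ∀ {x b} → x ~ b → Block L x ≅ Block L b
  Block-resp-~ x~b = record
    { to = λ (y , x~y) → y , ~-trans (~-sym x~b) x~y
    ; from = λ (y , b~y) → y , ~-trans x~b b~y
    ; to-cong = λ y≈y′ → y≈y′ ; from-cong = λ y≈y′ → y≈y′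
    ; from∘to = λ _ → Eq.refl ; to∘from = λ _ → Eq.refl
    ; to-mono = λ y<y′ → y<y′ ; to-refl = λ y<y′ → y<y′ }

  Least Greatest : Carrier → Set
  Least b    = ∀ z → b ~ z → ¬ z < b
  Greatest t = ∀ z → t ~ z → ¬ t < z

  least⇒¬occupied⁻ : ∀ {b} n → Least b → ¬ Occupied b -[1+ n ]
  least⇒¬occupied⁻ n b-least (z , p) = b-least z (~-sym (path⇒~ (suc n) p)) (path-< n p)

  greatest⇒¬occupied⁺ : ∀ {t} n → Greatest t → ¬ Occupied t (+ suc n)
  greatest⇒¬occupied⁺ n t-greatest (z , p) = t-greatest z (path⇒~ (suc n) p) (path-< n p)

  top⇒HasMax : ∀ {b y} a → Pos b y (+ a) → ¬ Occupied b (+ suc a) → HasMax (Block L b)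
  top⇒HasMax {b} {y} a p no-next = (y , pos⇒~ (+ a) p) , λ (z , b~z) y<z →
    let k , q = pos-total b~z in beyond z k q (pos-reflects (+ a) k p q y<z)
    where
    beyond : ∀ z k → Pos b z k → + a ℤ.< k → ⊥
    beyond z (+ m) q (ℤ.+<+ a<m) = no-next (occupied-↓⁺ (z , q) a<m)

  bottom⇒HasMin : ∀ {b y} a → Path a y b → ¬ Occupied b -[1+ a ] → HasMin (Block L b)
  bottom⇒HasMin {b} {y} a p no-next = (y , pos⇒~ (ℤ.- (+ a)) (bottom-pos a p)) , λ (z , b~z) z<y →
    let k , q = pos-total b~z
    in no-next (occupied-below a (z , q) (pos-reflects k (ℤ.- (+ a)) q (bottom-pos a p) z<y))
    where
    bottom-pos : ∀ a → Path a y b → Pos b y (ℤ.- (+ a))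
    bottom-pos zero    y≈b = Eq.sym y≈b
    bottom-pos (suc a) p   = p
    occupied-below : ∀ a {k} → Occupied b k → k ℤ.< ℤ.- (+ a) → Occupied b -[1+ a ]
    occupied-below zero    { -[1+ m ]} occ _           = occupied-↓⁻ {n = m} occ z≤n
    occupied-below (suc a) { -[1+ m ]} occ (ℤ.-<- a<m) = occupied-↓⁻ {n = m} occ a<m
    occupied-below zero    {+ _}       _   (ℤ.+<+ ())
    occupied-below (suc a) {+ _}       _   ()

  Block≅ℤ-suborder : ∀ {b} {S : ℤ → Set} → (∀ {k} → Occupied b k → S k) → (∀ {k} → S k → Occupied b k) →
                     Block L b ≅ ℤ-suborder S
  Block≅ℤ-suborder {b} {S} occ⇒S S⇒occ =
    ≅-trans (Block-linear b) (ℤ-suborder-linear S) (Block≅Occupied b) (ℤ-suborder-cong occ⇒S S⇒occ)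

  min⇒Least : ∀ {x b} (x~b : x ~ b) → (∀ y → ¬ OrdStr._<_ (Block L x) y (b , x~b)) → Least b
  min⇒Least x~b b-min z b~z = b-min (z , ~-trans x~b b~z)

  max⇒Greatest : ∀ {x t} (x~t : x ~ t) → (∀ y → ¬ OrdStr._<_ (Block L x) (t , x~t) y) → Greatest t
  max⇒Greatest x~t t-max z t~z = t-max (z , ~-trans x~t t~z)

  Block≅-resp-~ : ∀ {x b S} → x ~ b → Block L b ≅ ℤ-suborder S → Block L x ≅ ℤ-suborder S
  Block≅-resp-~ {x} {S = S} x~b = ≅-trans (Block-linear x) (ℤ-suborder-linear S) (Block-resp-~ x~b)

  finite-block : ∀ {b t} → Least b → Greatest t → b ~ t → ∃[ a ] Block L b ≅ ℤ-suborder (InColour (cn a))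
  finite-block {b} {t} b-least t-greatest b~t with pos-total b~t
  ... | -[1+ n ] , p = ⊥-elim (least⇒¬occupied⁻ n b-least (t , p))
  ... | + a      , p = a , Block≅ℤ-suborder occ⇒S S⇒occ
    where
    occ⇒S : ∀ {k} → Occupied b k → InColour (cn a) k
    occ⇒S { -[1+ n ]} occ     = ⊥-elim (least⇒¬occupied⁻ n b-least occ)
    occ⇒S {+ n}       (z , q) with ℕP.≤-<-connex n a
    ... | inj₁ n≤a = ℤ.+≤+ z≤n , ℤ.+<+ (s≤s n≤a)
    ... | inj₂ a<n = ⊥-elim (t-greatest z (~-trans (~-sym b~t) (pos⇒~ (+ n) q)) (pos-mono (+ a) (+ n) p q (ℤ.+<+ a<n)))
    S⇒occ : ∀ {k} → InColour (cn a) k → Occupied b k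
    S⇒occ {+ n} (_ , ℤ.+<+ n<1+a) = occupied-↓⁺ (t , p) (ℕ.s≤s⁻¹ n<1+a)

  infix 4 _≺_
  _≺_ : Carrier → Carrier → Set
  _≺_ = _<Φ_ L

  ≺-irrefl : ∀ {x y} → x ~ y → ¬ x ≺ y
  ≺-irrefl x~y x≺y = irrefl Eq.refl (x≺y _ _ ~-refl (~-sym x~y))

  ≺-trans : ∀ {x y z} → x ≺ y → y ≺ z → x ≺ z
  ≺-trans {y = y} x≺y y≺z x′ z′ x~x′ z~z′ = <-trans (x≺y x′ y x~x′ ~-refl) (y≺z y z′ ~-refl z~z′)

  ≺-respˡ : ∀ {x x′ y} → x ~ x′ → x ≺ y → x′ ≺ y
  ≺-respˡ x~x′ x≺y x″ y′ x′~x″ y~y′ = x≺y x″ y′ (~-trans x~x′ x′~x″) y~y′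

  ≺-respʳ : ∀ {x y y′} → y ~ y′ → x ≺ y → x ≺ y′
  ≺-respʳ y~y′ x≺y x′ y″ x~x′ y′~y″ = x≺y x′ y″ x~x′ (~-trans y~y′ y′~y″)

  ≺⇒< : ∀ {x y} → x ≺ y → x < y
  ≺⇒< x≺y = x≺y _ _ ~-refl ~-refl

  <-≁⇒≺ : ∀ {x y} → x < y → ¬ x ~ y → x ≺ y
  <-≁⇒≺ {x} {y} x<y x≁y x′ y′ x~x′ y~y′ with compare x′ y′
  ... | tri< x′<y′ _ _ = x′<y′
  ... | tri≈ _ x′≈y′ _ = ⊥-elim (x≁y (~-trans x~x′ (~-trans (≈⇒~ x′≈y′) (~-sym y~y′))))
  ... | tri> _ _ y′<x′ with compare x y′
  ...   | tri< x<y′ _ _ = ⊥-elim (x≁y (~-trans (~-convexˡ x<y′ y′<x′ x~x′) (~-sym y~y′)))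
  ...   | tri≈ _ x≈y′ _ = ⊥-elim (x≁y (~-trans (≈⇒~ x≈y′) (~-sym y~y′)))
  ...   | tri> _ _ y′<x = ⊥-elim (x≁y (~-convexʳ y′<x x<y (~-sym y~y′)))

  ΦCol→≅ : ∀ c {x} → ΦCol L c x → Block L x ≅ orderType c
  ΦCol→≅ cw     f = f
  ΦCol→≅ cz     f = f
  ΦCol→≅ csw    f = f
  ΦCol→≅ (cn _) f = f

  ≅→ΦCol : ∀ c {x} → Block L x ≅ orderType c → ΦCol L c x
  ≅→ΦCol cw     f = f
  ≅→ΦCol cz     f = f
  ≅→ΦCol csw    f = f
  ≅→ΦCol (cn _) f = f

  ΦCol-unique : ∀ {c c′ x y} → x ~ y → ΦCol L c x → ΦCol L c′ y → c ≡ c′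
  ΦCol-unique {c} {c′} {x} x~y p q = orderType-injective
    (≅-trans (orderType-linear c) (orderType-linear c′) (≅-sym (orderType-linear c) (ΦCol→≅ c p))
      (≅-trans (Block-linear x) (orderType-linear c′) (Block-resp-~ x~y) (ΦCol→≅ c′ q)))

  ΦCol⇒HasMin : ∀ c {x} → ΦCol L c x → T (hasMin c) → HasMin (Block L x)
  ΦCol⇒HasMin c {x} p has-min =
    HasMin-resp-≅ (Block-linear x) (≅-sym (orderType-linear c) (ΦCol→≅ c p)) (hasMin⇒HasMin c has-min)

  ΦCol⇒HasMax : ∀ c {x} → ΦCol L c x → T (hasMax c) → HasMax (Block L x)
  ΦCol⇒HasMax c {x} p has-max =
    HasMax-resp-≅ (Block-linear x) (≅-sym (orderType-linear c) (ΦCol→≅ c p)) (hasMax⇒HasMax c has-max)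

  module Classification (em : ExcludedMiddle 0ℓ) where

    exit-point : (Q : ℕ → Set) → Q 0 → ∀ N → ¬ Q N → ∃[ a ] Q a × ¬ Q (suc a)
    exit-point Q q₀ zero    ¬q = ⊥-elim (¬q q₀)
    exit-point Q q₀ (suc N) ¬q with em {Q N}
    ... | yes q  = N , q , ¬q
    ... | no ¬q′ = exit-point Q q₀ N ¬q′

    all-above-or-max : ∀ b → (∀ n → Occupied b (+ n)) ⊎ HasMax (Block L b)
    all-above-or-max b with em {∃[ N ] ¬ Occupied b (+ N)}
    ... | yes (N , gap) = let a , (_ , p) , ¬next = exit-point (Occupied b ∘ +_) (b , Eq.refl) N gap
                          in inj₂ (top⇒HasMax a p ¬next)
    ... | no ¬gap       = inj₁ λ n → em⇒dne em λ ¬occ → ¬gap (n , ¬occ)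

    all-below-or-min : ∀ b → (∀ n → Occupied b -[1+ n ]) ⊎ HasMin (Block L b)
    all-below-or-min b with em {∃[ N ] ¬ Occupied b -[1+ N ]}
    ... | yes (N , gap) = let a , (_ , p) , ¬next = exit-point (λ n → ∃[ y ] Path n y b) (b , Eq.refl) (suc N) gap
                          in inj₂ (bottom⇒HasMin a p ¬next)
    ... | no ¬gap       = inj₁ λ n → em⇒dne em λ ¬occ → ¬gap (n , ¬occ)

    ω-block : ∀ {b} → Least b → ¬ HasMax (Block L b) → Block L b ≅ ℤ-suborder (InColour cw)
    ω-block {b} b-least ¬max with all-above-or-max b
    ... | inj₂ max   = ⊥-elim (¬max max)
    ... | inj₁ above = Block≅ℤ-suborder occ⇒S λ { {+ n} _ → above n }
      where
      occ⇒S : ∀ {k} → Occupied b k → InColour cw k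
      occ⇒S {+ _}       _   = ℤ.+≤+ z≤n
      occ⇒S { -[1+ n ]} occ = ⊥-elim (least⇒¬occupied⁻ n b-least occ)

    ω*-block : ∀ {t} → Greatest t → ¬ HasMin (Block L t) → Block L t ≅ ℤ-suborder (InColour csw)
    ω*-block {t} t-greatest ¬min with all-below-or-min t
    ... | inj₂ min   = ⊥-elim (¬min min)
    ... | inj₁ below =
      -- positions relative to t are ≤ 0, so shifting them by one gives the negative integers
      ≅-trans (Block-linear t) (ℤ-suborder-linear _) (Block≅Occupied t)
        (≅-trans (ℤ-suborder-linear _) (ℤ-suborder-linear _)
          (≅-sym (ℤ-suborder-linear _) (ℤ-suborder-shift (Occupied t)))
          (ℤ-suborder-cong occ⇒S S⇒occ))
      where
      occ⇒S : ∀ {k} → Occupied t (ℤ.suc k) → InColour csw k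
      occ⇒S {+ n}       occ = ⊥-elim (greatest⇒¬occupied⁺ n t-greatest occ)
      occ⇒S { -[1+ _ ]} _   = ℤ.-<+
      S⇒occ : ∀ {k} → InColour csw k → Occupied t (ℤ.suc k)
      S⇒occ { -[1+ zero ]}  _ = t , Eq.refl
      S⇒occ { -[1+ suc n ]} _ = below n
      S⇒occ {+ _} (ℤ.+<+ ())

    ζ-block : ∀ {b} → ¬ HasMin (Block L b) → ¬ HasMax (Block L b) → Block L b ≅ ℤ-suborder (InColour cz)
    ζ-block {b} ¬min ¬max with all-below-or-min b | all-above-or-max b
    ... | inj₂ min   | _          = ⊥-elim (¬min min)
    ... | _          | inj₂ max   = ⊥-elim (¬max max)
    ... | inj₁ below | inj₁ above = Block≅ℤ-suborder (λ _ → tt) λ { {+ n} _ → above n ; { -[1+ n ]} _ → below n }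

    classify : ∀ x → ∃[ c ] Block L x ≅ ℤ-suborder (InColour c)
    classify x with em {HasMin (Block L x)} | em {HasMax (Block L x)}
    ... | yes ((b , x~b) , b-min) | yes ((t , x~t) , t-max) =
      let a , f = finite-block (min⇒Least x~b b-min) (max⇒Greatest x~t t-max) (~-trans (~-sym x~b) x~t)
      in cn a , Block≅-resp-~ x~b f
    ... | yes ((b , x~b) , b-min) | no ¬max =
      cw , Block≅-resp-~ x~b (ω-block (min⇒Least x~b b-min) (¬max ∘ HasMax-resp-≅ (Block-linear x) (Block-resp-~ (~-sym x~b))))
    ... | no ¬min | yes ((t , x~t) , t-max) =
      csw , Block≅-resp-~ x~t (ω*-block (max⇒Greatest x~t t-max) (¬min ∘ HasMin-resp-≅ (Block-linear x) (Block-resp-~ (~-sym x~t))))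
    ... | no ¬min | no ¬max = cz , ζ-block ¬min ¬max

    classify-orderType : ∀ x → ∃[ c ] ΦCol L c x
    classify-orderType x =
      let c , f = classify x in c , ≅→ΦCol c (≅-trans (Block-linear x) (orderType-linear c) f (InColour≅orderType c))

    ≺-compare : ∀ x y → Tri (x ≺ y) (x ~ y) (y ≺ x)
    ≺-compare x y with em {x ~ y}
    ... | yes x~y = tri≈ (≺-irrefl x~y) x~y (≺-irrefl (~-sym x~y))
    ... | no x≁y with compare x y
    ...   | tri< x<y _ _ = tri< (<-≁⇒≺ x<y x≁y) x≁y (asym x<y ∘ ≺⇒<)
    ...   | tri≈ _ x≈y _ = ⊥-elim (x≁y (≈⇒~ x≈y))
    ...   | tri> _ _ y<x = tri> (asym y<x ∘ ≺⇒<) x≁y (<-≁⇒≺ y<x (x≁y ∘ ~-sym))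

    Φ-linear : IsLinOrd (TStr.ord (Φ L))
    Φ-linear = record
      { isStrictPartialOrder = record
        { isEquivalence = record { refl = ~-refl ; sym = ~-sym ; trans = ~-trans }
        ; irrefl = ≺-irrefl
        ; trans = ≺-trans
        ; <-resp-≈ = ≺-respʳ , ≺-respˡ }
      ; compare = ≺-compare }

    Φ-gap : ∀ {x y} → x ≺ y → HasMax (Block L x) → HasMin (Block L y) → Gap (Φ L) x y
    Φ-gap {x} {y} x≺y ((a , x~a) , a-max) ((b , y~b) , b-min) with em {∃[ u ] a < u × u < b}
    ... | yes (u , a<u , u<b) =
      u , ≺-respˡ (~-sym x~a) (<-≁⇒≺ a<u λ a~u → a-max (u , ~-trans x~a a~u) a<u)
        , ≺-respʳ (~-sym y~b) (<-≁⇒≺ u<b λ u~b → b-min (u , ~-trans y~b (~-sym u~b)) u<b)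
    ... | no nothing-between = ⊥-elim (≺-irrefl (~-trans x~a (~-trans a~b (~-sym y~b))) x≺y)
      where
      a~b : a ~ b
      a~b = [] , λ { u (inj₁ (a<u , u<b)) → ⊥-elim (nothing-between (u , a<u , u<b))
                   ; u (inj₂ (b<u , u<a)) → ⊥-elim (asym (x≺y a b x~a y~b) (<-trans b<u u<a)) }

    Φ-model : IsModelT (Φ L)
    Φ-model = record
      { linear = Φ-linear
      ; P-resp = λ c {x} x~y p → ≅→ΦCol c (≅-trans (Block-linear _) (orderType-linear c) (Block-resp-~ (~-sym x~y)) (ΦCol→≅ c p))
      ; ax2 = classify-orderType
      ; ax3 = λ c c′ x p q → ΦCol-unique ~-refl p q
      ; ax4 = λ i j x y x≺y p q → Φ-gap x≺y (ΦCol⇒HasMax (cn i) p tt) (ΦCol⇒HasMin (cn j) q tt)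
      ; ax5 = λ i x y x≺y p q → Φ-gap x≺y (ΦCol⇒HasMax (cn i) p tt) (ΦCol⇒HasMin cw q tt)
      ; ax6 = λ i x y x≺y p q → Φ-gap x≺y (ΦCol⇒HasMax csw p tt) (ΦCol⇒HasMin (cn i) q tt)
      ; ax7 = λ x y x≺y p q → Φ-gap x≺y (ΦCol⇒HasMax csw p tt) (ΦCol⇒HasMin cw q tt) }

-- Ordered sums along models of T

Ψ-linear : ∀ K → IsLinOrd (TStr.ord K) → IsLinOrd (Ψ K)
Ψ-linear K lin = On.isStrictTotalOrder proj₁ (×-isStrictTotalOrder lin ℤP.<-isStrictTotalOrder)

Ψ-countable : ∀ K → Countable (TStr.ord K) → Countable (Ψ K)
Ψ-countable K (f , f-cong , f-injective) =
    (λ ((x , i) , _) → pair (f x) (encodeℤ i))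
  , (λ _ _ (x≈y , i≡j) → cong₂ pair (f-cong _ _ x≈y) (cong encodeℤ i≡j))
  , λ ((x , i) , _) ((y , j) , _) eq →
      let fx≡fy , i≡j = pair-injective {f x} {encodeℤ i} {f y} {encodeℤ j} eq
      in f-injective x y fx≡fy , encodeℤ-injective i≡j

module _ (K : TStr) where
  open TStr K

  InColour⇒InD : ∀ c {x i} → P c x → InColour c i → InD K x i
  InColour⇒InD cw     px i≥0         = inj₁ (px , i≥0)
  InColour⇒InD cz     px _           = inj₂ (inj₁ px)
  InColour⇒InD csw    px i<0         = inj₂ (inj₂ (inj₁ (px , i<0)))
  InColour⇒InD (cn k) px (i≥0 , i<k) = inj₂ (inj₂ (inj₂ (k , px , i≥0 , i<k)))

  InD⇒InColour : ∀ {x i} → InD K x i → ∃[ c ] P c x × InColour c i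
  InD⇒InColour (inj₁ (px , i≥0))                     = cw , px , i≥0
  InD⇒InColour (inj₂ (inj₁ px))                      = cz , px , tt
  InD⇒InColour (inj₂ (inj₂ (inj₁ (px , i<0))))       = csw , px , i<0
  InD⇒InColour (inj₂ (inj₂ (inj₂ (k , px , i≥0 , i<k)))) = cn k , px , i≥0 , i<k

module SumOf (em : ExcludedMiddle 0ℓ) {K : TStr} (M : IsModelT K) where

  open TStr K
  open IsModelT M
  open LinOrd linear renaming (trans to <-trans)
  module ΨK = Condensation (Ψ-linear K linear)
  module ΨL = LinOrd (Ψ-linear K linear)
  open ΨK using (_≺_)

  ΨC : Set
  ΨC = ΨCarrier K

  infix 4 _≈Ψ_ _<Ψ_
  _≈Ψ_ _<Ψ_ : ΨC → ΨC → Set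
  _≈Ψ_ = OrdStr._≈_ (Ψ K)
  _<Ψ_ = OrdStr._<_ (Ψ K)

  point : ΨC → Carrier
  point = proj₁ ∘ proj₁

  gap : ∀ {c c′ x y} → P c x → P c′ y → T (hasMax c) → T (hasMin c′) → x < y → Gap K x y
  gap {csw}  {cw}   px py _ _ x<y = ax7 _ _ x<y px py
  gap {csw}  {cn j} px py _ _ x<y = ax6 j _ _ x<y px py
  gap {cn i} {cw}   px py _ _ x<y = ax5 i _ _ x<y px py
  gap {cn i} {cn j} px py _ _ x<y = ax4 i j _ _ x<y px py
  gap {cw}   _  _  () _
  gap {cz}   _  _  () _
  gap {csw}  {cz}  _ _ _ ()
  gap {csw}  {csw} _ _ _ ()
  gap {cn _} {cz}  _ _ _ ()
  gap {cn _} {csw} _ _ _ ()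

  InD⇒InColour-of : ∀ {c x i} → P c x → InD K x i → InColour c i
  InD⇒InColour-of {c} {x} {i} px q with InD⇒InColour K q
  ... | c′ , px′ , s = subst (λ c → InColour c i) (ax3 c′ c x px′ px) s

  InD-resp : ∀ {x y i} → x ≈ y → InD K x i → InD K y i
  InD-resp x≈y q with InD⇒InColour K q
  ... | c , px , s = InColour⇒InD K c (P-resp c x≈y px) s

  anchorPoint : Carrier → ΨC
  anchorPoint x = let c , px = ax2 x in (x , anchor c) , InColour⇒InD K c px (anchor-InColour c)

  ascending : ∀ {c x} → P c x → ¬ T (hasMax c) → ℤ → ℕ → ΨC
  ascending {c} {x} px no-max i n =
    (x , + suc (n + ∣ i ∣)) , InColour⇒InD K c px (InColour-unbounded↑ c no-max _)

  descending : ∀ {c x} → P c x → ¬ T (hasMin c) → ℤ → ℕ → ΨC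
  descending {c} {x} px no-min i n =
    (x , -[1+ n + ∣ i ∣ ]) , InColour⇒InD K c px (InColour-unbounded↓ c no-min _)

  ascending-injective : ∀ {c x} (px : P c x) (no-max : ¬ T (hasMax c)) i m n →
                        ascending px no-max i m ≈Ψ ascending px no-max i n → m ≡ n
  ascending-injective _ _ i m n (_ , eq) = ℕP.+-cancelʳ-≡ ∣ i ∣ m n (ℕP.suc-injective (ℤP.+-injective eq))

  descending-injective : ∀ {c x} (px : P c x) (no-min : ¬ T (hasMin c)) i m n →
                         descending px no-min i m ≈Ψ descending px no-min i n → m ≡ n
  descending-injective _ _ i m n (_ , eq) = ℕP.+-cancelʳ-≡ ∣ i ∣ m n (ℤP.-[1+-injective eq)

  <-ascending : ∀ i n → i ℤ.< + suc (n + ∣ i ∣)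
  <-ascending (+ m)      n = ℤ.+<+ (s≤s (ℕP.m≤n+m m n))
  <-ascending -[1+ m ]   n = ℤ.-<+

  descending-< : ∀ i n → -[1+ n + ∣ i ∣ ] ℤ.< i
  descending-< (+ m)      n = ℤ.-<+
  descending-< -[1+ m ]   n = ℤ.-<- (ℕP.m≤n+m (suc m) n)

  open Condensation linear using (descending-chain; decreasing⇒injective)

  module FarApart {x x′ i i′} {p : InD K x i} {p′ : InD K x′ i′}
                  (x<x′ : x < x′) (a~a′ : ((x , i) , p) ΨK.~ ((x′ , i′) , p′)) where

    infinitely-many : (g : ℕ → ΨC) → (∀ m n → g m ≈Ψ g n → m ≡ n) →
                      ¬ (∀ n → ((x , i) , p) <Ψ g n × g n <Ψ ((x′ , i′) , p′))
    infinitely-many = ΨK.~⇒¬injection-between {(x , i) , p} {(x′ , i′) , p′} a~a′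

    -- If every colour strictly between x and x′ has a least element, the gap axioms give a
    -- descending chain.
    all-have-min⇒⊥ : ∀ {c c′} → P c x → P c′ x′ → T (hasMax c) → T (hasMin c′) →
                     (∀ u → x < u → u < x′ → T (hasMin (proj₁ (ax2 u)))) → ⊥
    all-have-min⇒⊥ px px′ has-max has-min all-have-min =
      infinitely-many (anchorPoint ∘ g) (λ m n eq → decreasing⇒injective g decreasing m n (proj₁ eq))
        λ n → inj₁ (proj₁ (between n)) , inj₁ (proj₂ (between n))
      where
      chain = descending-chain (gap px px′ has-max has-min x<x′)
                λ u x<u u<x′ → gap px (proj₂ (ax2 u)) has-max (all-have-min u x<u u<x′) x<u
      g = proj₁ chain
      between = proj₁ (proj₂ chain)
      decreasing = proj₂ (proj₂ chain)

    contradiction : ⊥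
    contradiction with ax2 x | ax2 x′
    ... | c , px | c′ , px′ with T? (hasMax c) | T? (hasMin c′)
    ... | no no-max | _ =
      infinitely-many (ascending px no-max i) (ascending-injective px no-max i)
        λ n → inj₂ (Eq.refl , <-ascending i n) , inj₁ x<x′
    ... | _ | no no-min =
      infinitely-many (descending px′ no-min i′) (descending-injective px′ no-min i′)
        λ n → inj₁ x<x′ , inj₂ (Eq.refl , descending-< i′ n)
    ... | yes has-max | yes has-min with em {∃[ u ] x < u × u < x′ × ¬ T (hasMin (proj₁ (ax2 u)))}
    ...   | yes (u , x<u , u<x′ , no-min) =
      infinitely-many (descending (proj₂ (ax2 u)) no-min (+ 0)) (descending-injective (proj₂ (ax2 u)) no-min (+ 0))
        λ _ → inj₁ x<u , inj₁ u<x′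
    ...   | no ¬some-without-min = all-have-min⇒⊥ px px′ has-max has-min
      λ u x<u u<x′ → em⇒dne em λ no-min → ¬some-without-min (u , x<u , u<x′ , no-min)

  far-apart : ∀ {x x′ i i′} {p : InD K x i} {p′ : InD K x′ i′} →
              x < x′ → ¬ (((x , i) , p) ΨK.~ ((x′ , i′) , p′))
  far-apart {x} {x′} {i} {i′} {p} {p′} x<x′ a~a′ = FarApart.contradiction {x} {x′} {i} {i′} {p} {p′} x<x′ a~a′

  same-point : ∀ {a b} → a ΨK.~ b → point a ≈ point b
  same-point {a@((x , _) , p)} {b@((y , _) , q)} a~b with compare x y
  ... | tri< x<y _ _ = ⊥-elim (far-apart {p = p} {q} x<y a~b)
  ... | tri≈ _ x≈y _ = x≈y
  ... | tri> _ _ y<x = ⊥-elim (far-apart {p = q} {p} y<x (ΨK.~-sym {a} {b} a~b))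

  pointAt : Carrier → ℤ → List ΨC
  pointAt x i with em {InD K x i}
  ... | yes q = ((x , i) , q) ∷ []
  ... | no _  = []

  pointsUpTo : Carrier → ℕ → List ΨC
  pointsUpTo x zero    = []
  pointsUpTo x (suc N) = pointAt x (+ N) ++ pointAt x (ℤ.- (+ N)) ++ pointsUpTo x N

  ∈-pointAt : ∀ {x y i} (q : InD K y i) → y ≈ x → Any (((y , i) , q) ≈Ψ_) (pointAt x i)
  ∈-pointAt {x} {y} {i} q y≈x with em {InD K x i}
  ... | yes _ = here (y≈x , refl)
  ... | no ¬q = ⊥-elim (¬q (InD-resp y≈x q))

  ∈-pointsUpTo : ∀ {x y l} N (q : InD K y l) → y ≈ x → ∣ l ∣ ℕ.< N → Any (((y , l) , q) ≈Ψ_) (pointsUpTo x N)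
  ∈-pointsUpTo {x} {l = + m} (suc N) q y≈x m<1+N with ℕP.m≤n⇒m<n∨m≡n (ℕ.s≤s⁻¹ m<1+N)
  ... | inj₁ m<N  = AnyP.++⁺ʳ (pointAt x (+ N)) (AnyP.++⁺ʳ (pointAt x (ℤ.- (+ N))) (∈-pointsUpTo N q y≈x m<N))
  ... | inj₂ refl = AnyP.++⁺ˡ (∈-pointAt q y≈x)
  ∈-pointsUpTo {x} {l = -[1+ m ]} (suc N) q y≈x 1+m<1+N with ℕP.m≤n⇒m<n∨m≡n (ℕ.s≤s⁻¹ 1+m<1+N)
  ... | inj₁ 1+m<N = AnyP.++⁺ʳ (pointAt x (+ N)) (AnyP.++⁺ʳ (pointAt x (ℤ.- (+ N))) (∈-pointsUpTo N q y≈x 1+m<N))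
  ... | inj₂ refl  = AnyP.++⁺ʳ (pointAt x (+ N)) (AnyP.++⁺ˡ (∈-pointAt q y≈x))

  ∣∣-between : ∀ {i l j} → i ℤ.< l → l ℤ.< j → ∣ l ∣ ℕ.≤ ∣ i ∣ + ∣ j ∣
  ∣∣-between {i}      {+ _}      {+ _}      _             (ℤ.+<+ l<j) = ℕP.≤-trans (ℕP.<⇒≤ l<j) (ℕP.m≤n+m _ ∣ i ∣)
  ∣∣-between { -[1+ m ]} { -[1+ _ ]} {j}     (ℤ.-<- l<i) _           = ℕP.≤-trans l<i (ℕP.m≤n⇒m≤1+n (ℕP.m≤m+n m ∣ j ∣))
  ∣∣-between {+ _}    { -[1+ _ ]} ()
  ∣∣-between {l = + _} {j = -[1+ _ ]} _ ()

  private
    between-same-point : ∀ {x x′ y i j l} → x ≈ x′ → (x < y) ⊎ (x ≈ y × i ℤ.< l) → (y < x′) ⊎ (y ≈ x′ × l ℤ.< j) →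
                         y ≈ x × i ℤ.< l × l ℤ.< j
    between-same-point x≈x′ (inj₂ (x≈y , i<l)) (inj₂ (_ , l<j))    = Eq.sym x≈y , i<l , l<j
    between-same-point x≈x′ (inj₁ x<y)         (inj₁ y<x′)        = ⊥-elim (irrefl x≈x′ (<-trans x<y y<x′))
    between-same-point x≈x′ (inj₁ x<y)         (inj₂ (y≈x′ , _))  = ⊥-elim (irrefl x≈x′ (<-respʳ-≈ y≈x′ x<y))
    between-same-point x≈x′ (inj₂ (x≈y , _))   (inj₁ y<x′)        = ⊥-elim (irrefl x≈x′ (<-respˡ-≈ (Eq.sym x≈y) y<x′))

  fibre-~ : ∀ {x x′ i j} (p : InD K x i) (p′ : InD K x′ j) → x ≈ x′ → ((x , i) , p) ΨK.~ ((x′ , j) , p′)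
  fibre-~ {x} {x′} {i} {j} p p′ x≈x′ = pointsUpTo x (suc (∣ i ∣ + ∣ j ∣)) , cover
    where
    cover : ∀ u → Between (Ψ K) ((x , i) , p) ((x′ , j) , p′) u → Any (u ≈Ψ_) (pointsUpTo x (suc (∣ i ∣ + ∣ j ∣)))
    cover ((y , l) , q) (inj₁ (a<u , u<a′)) =
      let y≈x , i<l , l<j = between-same-point x≈x′ a<u u<a′
      in ∈-pointsUpTo _ q y≈x (s≤s (∣∣-between i<l l<j))
    cover ((y , l) , q) (inj₂ (a′<u , u<a)) =
      let y≈x′ , j<l , l<i = between-same-point (Eq.sym x≈x′) a′<u u<a
      in ∈-pointsUpTo _ q (Eq.trans y≈x′ (Eq.sym x≈x′))
           (s≤s (subst (∣ l ∣ ℕ.≤_) (ℕP.+-comm ∣ j ∣ ∣ i ∣) (∣∣-between j<l l<i)))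

  Block≅InD : ∀ a → Block (Ψ K) a ≅ ℤ-suborder (InD K (point a))
  Block≅InD a@((x , i) , p) = record
    { to = λ (u@((_ , l) , q) , a~u) → l , InD-resp (Eq.sym (same-point {a} {u} a~u)) q
    ; from = λ (l , q) → ((x , l) , q) , fibre-~ p q Eq.refl
    ; to-cong = proj₂
    ; from-cong = λ { refl → Eq.refl , refl }
    ; from∘to = λ (u , a~u) → same-point {a} {u} a~u , refl
    ; to∘from = λ _ → refl
    ; to-mono = λ { {u , a~u} {u′ , a~u′} u<u′ → index-< (same-point {a} {u} a~u) (same-point {a} {u′} a~u′) u<u′ }
    ; to-refl = λ { {u , a~u} {u′ , a~u′} l<l′ →
        inj₂ (Eq.trans (Eq.sym (same-point {a} {u} a~u)) (same-point {a} {u′} a~u′) , l<l′) } }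
    where
    index-< : ∀ {y y′ l l′} → x ≈ y → x ≈ y′ → (y < y′) ⊎ (y ≈ y′ × l ℤ.< l′) → l ℤ.< l′
    index-< x≈y x≈y′ (inj₁ y<y′)      = ⊥-elim (irrefl (Eq.trans (Eq.sym x≈y) x≈y′) y<y′)
    index-< _   _    (inj₂ (_ , l<l′)) = l<l′

  Block≅orderType : ∀ {c} a → P c (point a) → Block (Ψ K) a ≅ orderType c
  Block≅orderType {c} a pa =
    ≅-trans (ΨK.Block-linear a) (orderType-linear c) (Block≅InD a)
      (≅-trans (ℤ-suborder-linear _) (orderType-linear c)
        (ℤ-suborder-cong (InD⇒InColour-of pa) (InColour⇒InD K c pa)) (InColour≅orderType c))

  ≺⇒point< : ∀ {a b} → a ≺ b → point a < point b
  ≺⇒point< {a@((x , _) , p)} {b@((y , _) , q)} a≺b with compare x y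
  ... | tri< x<y _ _ = x<y
  ... | tri≈ _ x≈y _ = ⊥-elim (ΨK.≺-irrefl {a} {b} (fibre-~ p q x≈y) a≺b)
  ... | tri> _ _ y<x = ⊥-elim (ΨL.asym {a} {b} (ΨK.≺⇒< {a} {b} a≺b) (inj₁ y<x))

  point<⇒≺ : ∀ {a b} → point a < point b → a ≺ b
  point<⇒≺ {a} {b} x<y a′ b′ a~a′ b~b′ =
    inj₁ (<-respʳ-≈ (same-point {b} {b′} b~b′) (<-respˡ-≈ (same-point {a} {a′} a~a′) x<y))

  Φ[Ψ]≅ : Φ (Ψ K) ≅ₜ K
  Φ[Ψ]≅ = record
    { iso = record
      { to = point
      ; from = anchorPoint
      ; to-cong = λ {a} {b} → same-point {a} {b}
      ; from-cong = λ {x} {y} x≈y → fibre-~ (proj₂ (anchorPoint x)) (proj₂ (anchorPoint y)) x≈y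
      ; from∘to = λ a → fibre-~ (proj₂ (anchorPoint (point a))) (proj₂ a) Eq.refl
      ; to∘from = λ _ → Eq.refl
      ; to-mono = λ {a} {b} → ≺⇒point< {a} {b}
      ; to-refl = λ {a} {b} → point<⇒≺ {a} {b} }
    ; P-to = λ c a pc → let c′ , pc′ = ax2 (point a) in
        subst (λ c → P c (point a)) (ΨK.ΦCol-unique {c′} {c} {a} {a} (ΨK.~-refl {a}) (ΨK.≅→ΦCol c′ (Block≅orderType a pc′)) pc) pc′
    ; P-from = λ c a pa → ΨK.≅→ΦCol c (Block≅orderType a pa) }

module Reconstruction (em : ExcludedMiddle 0ℓ) {L : OrdStr} (lin : IsLinOrd L) (cnt : Countable L) where

  open OrdStr L
  open LinOrd lin renaming (trans to <-trans)
  open Condensation lin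
  open Classification em

  code : Carrier → ℕ
  code = proj₁ cnt

  code-injective : ∀ x y → code x ≡ code y → x ≈ y
  code-injective = proj₂ (proj₂ cnt)

  Minimum : (ℕ → Set) → Set
  Minimum Q = ∃[ n ] Q n × (∀ k → k ℕ.< n → ¬ Q k)

  minimum : ∀ {Q} n → Q n → Minimum Q
  minimum {Q} = <-rec (λ n → Q n → Minimum Q) step
    where
    step : ∀ n → (∀ {k} → k ℕ.< n → Q k → Minimum Q) → Q n → Minimum Q
    step n rec qn with em {∃[ k ] k ℕ.< n × Q k}
    ... | yes (k , k<n , qk) = rec k<n qk
    ... | no ¬smaller        = n , qn , λ k k<n qk → ¬smaller (k , k<n , qk)

  minimum-unique : ∀ {Q Q′} → (∀ {n} → Q n → Q′ n) → (∀ {n} → Q′ n → Q n) →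
                   (m : Minimum Q) (m′ : Minimum Q′) → proj₁ m ≡ proj₁ m′
  minimum-unique Q⇒Q′ Q′⇒Q (m , qm , m-least) (m′ , qm′ , m′-least) with ℕP.<-cmp m m′
  ... | tri< m<m′ _ _ = ⊥-elim (m′-least m m<m′ (Q⇒Q′ qm))
  ... | tri≈ _ m≡m′ _ = m≡m′
  ... | tri> _ _ m′<m = ⊥-elim (m-least m′ m′<m (Q′⇒Q qm′))

  CodeInBlock : Carrier → ℕ → Set
  CodeInBlock x n = ∃[ y ] x ~ y × code y ≡ n

  least-code : ∀ x → Minimum (CodeInBlock x)
  least-code x = minimum (code x) (x , ~-refl , refl)

  least-code-cong : ∀ {x x′} → x ~ x′ → proj₁ (least-code x) ≡ proj₁ (least-code x′)
  least-code-cong x~x′ = minimum-unique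
    (λ (y , x~y , eq) → y , ~-trans (~-sym x~x′) x~y , eq)
    (λ (y , x′~y , eq) → y , ~-trans x~x′ x′~y , eq)
    (least-code _) (least-code _)

  -- The element with code n; the default d is returned only when there is none.
  decode : ℕ → Carrier → Carrier
  decode n d with em {∃[ r ] code r ≡ n}
  ... | yes (r , _) = r
  ... | no _        = d

  code-decode : ∀ n d → ∃[ r ] code r ≡ n → code (decode n d) ≡ n
  code-decode n d r with em {∃[ r ] code r ≡ n}
  ... | yes (_ , eq) = eq
  ... | no none      = ⊥-elim (none r)

  decode-default-irrelevant : ∀ n d d′ → ∃[ r ] code r ≡ n → decode n d ≡ decode n d′
  decode-default-irrelevant n d d′ r with em {∃[ r ] code r ≡ n}
  ... | yes _   = refl
  ... | no none = ⊥-elim (none r)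

  representative : Carrier → Carrier
  representative x = decode (proj₁ (least-code x)) x

  representative-~ : ∀ x → x ~ representative x
  representative-~ x =
    let n , (y , x~y , code-y) , _ = least-code x
    in ~-trans x~y (≈⇒~ (code-injective _ _ (trans code-y (sym (code-decode n x (y , code-y))))))

  representative-cong : ∀ {x x′} → x ~ x′ → representative x ≡ representative x′
  representative-cong {x} {x′} x~x′ =
    let n , (y , _ , code-y) , _ = least-code x
    in trans (decode-default-irrelevant n x x′ (y , code-y)) (cong (λ m → decode m x′) (least-code-cong x~x′))

  colourOf : Carrier → Col
  colourOf r = proj₁ (classify r)

  chart : ∀ r → Block L r ≅ ℤ-suborder (InColour (colourOf r))
  chart r = proj₂ (classify r)

  at : ∀ r {i} → InColour (colourOf r) i → Carrier
  at r {i} s = proj₁ (_≅_.from (chart r) (i , s))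

  at-~ : ∀ r {i} (s : InColour (colourOf r) i) → r ~ at r s
  at-~ r {i} s = proj₂ (_≅_.from (chart r) (i , s))

  at-cong : ∀ {r r′ i i′} (s : InColour (colourOf r) i) (s′ : InColour (colourOf r′) i′) →
            r ≡ r′ → i ≡ i′ → at r s ≈ at r′ s′
  at-cong {r} _ _ refl refl = _≅_.from-cong (chart r) refl

  at-mono : ∀ {r r′ i i′} (s : InColour (colourOf r) i) (s′ : InColour (colourOf r′) i′) →
            r ≡ r′ → i ℤ.< i′ → at r s < at r′ s′
  at-mono {r} _ _ refl = _≅_.to-mono (≅-sym (ℤ-suborder-linear _) (chart r))

  index : ∀ r {y} → r ~ y → ℤ
  index r {y} r~y = proj₁ (_≅_.to (chart r) (y , r~y))

  index-InColour : ∀ r {y} (r~y : r ~ y) → InColour (colourOf r) (index r r~y)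
  index-InColour r {y} r~y = proj₂ (_≅_.to (chart r) (y , r~y))

  index-cong : ∀ {r r′ y y′} (r~y : r ~ y) (r′~y′ : r′ ~ y′) → r ≡ r′ → y ≈ y′ → index r r~y ≡ index r′ r′~y′
  index-cong {r} _ _ refl = _≅_.to-cong (chart r)

  at-index : ∀ r {y} (r~y : r ~ y) → at r (index-InColour r r~y) ≈ y
  at-index r {y} r~y = _≅_.from∘to (chart r) (y , r~y)

  index-at : ∀ r {i} (s : InColour (colourOf r) i) → index r (at-~ r s) ≡ i
  index-at r {i} s = _≅_.to∘from (chart r) (i , s)

  ΦCol-colourOf : ∀ {x r} → r ~ x → ΦCol L (colourOf r) x
  ΦCol-colourOf r~x = IsModelT.P-resp Φ-model _ r~x (proj₂ (classify-orderType _))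

  InD⇒InColour-colourOf : ∀ {x r i} → x ~ r → InD (Φ L) x i → InColour (colourOf r) i
  InD⇒InColour-colourOf {i = i} x~r p with InD⇒InColour (Φ L) p
  ... | c , px , s = subst (λ c → InColour c i) (ΦCol-unique x~r px (ΦCol-colourOf ~-refl)) s

  ΨΦC : Set
  ΨΦC = ΨCarrier (Φ L)

  toL : ΨΦC → Carrier
  toL ((x , _) , p) = at (representative x) (InD⇒InColour-colourOf (representative-~ x) p)

  toL-~ : ∀ (a : ΨΦC) → proj₁ (proj₁ a) ~ toL a
  toL-~ ((x , _) , p) = ~-trans (representative-~ x) (at-~ _ _)

  fromL : Carrier → ΨΦC
  fromL y = (y , index r r~y) , InColour⇒InD (Φ L) (colourOf r) (ΦCol-colourOf r~y) (index-InColour r r~y)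
    where
    r = representative y
    r~y = ~-sym (representative-~ y)

  toL-reflects : ∀ a b → toL a < toL b → OrdStr._<_ (Ψ (Φ L)) a b
  toL-reflects a@((x , i) , _) b@((x′ , i′) , _) lt = by-block (≺-compare x x′)
    where
    by-index : x ~ x′ → Tri (i ℤ.< i′) (i ≡ i′) (i′ ℤ.< i) → OrdStr._<_ (Ψ (Φ L)) a b
    by-index x~x′ (tri< i<i′ _ _) = inj₂ (x~x′ , i<i′)
    by-index x~x′ (tri≈ _ i≡i′ _) = ⊥-elim (irrefl (at-cong _ _ (representative-cong x~x′) i≡i′) lt)
    by-index x~x′ (tri> _ _ i′<i) = ⊥-elim (asym lt (at-mono _ _ (representative-cong (~-sym x~x′)) i′<i))
    by-block : Tri (x ≺ x′) (x ~ x′) (x′ ≺ x) → OrdStr._<_ (Ψ (Φ L)) a b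
    by-block (tri< x≺x′ _ _) = inj₁ x≺x′
    by-block (tri≈ _ x~x′ _) = by-index x~x′ (ℤP.<-cmp i i′)
    by-block (tri> _ _ x′≺x) = ⊥-elim (asym lt (x′≺x _ _ (toL-~ b) (toL-~ a)))

  Ψ[Φ]≅ : Ψ (Φ L) ≅ L
  Ψ[Φ]≅ = record
    { to = toL
    ; from = fromL
    ; to-cong = λ { {(x , _) , _} (x~x′ , i≡i′) → at-cong _ _ (representative-cong x~x′) i≡i′ }
    ; from-cong = λ y≈y′ → ≈⇒~ y≈y′ , index-cong _ _ (representative-cong (≈⇒~ y≈y′)) y≈y′
    ; from∘to = λ { a@((x , i) , p) → ~-sym (toL-~ a)
                  , trans (index-cong _ _ (representative-cong (~-sym (toL-~ a))) Eq.refl) (index-at _ _) }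
    ; to∘from = λ y → Eq.trans (at-cong _ _ refl refl) (at-index _ _)
    ; to-mono = λ { {a} {b} (inj₁ x≺x′) → x≺x′ _ _ (toL-~ a) (toL-~ b)
                  ; {(x , _) , _} (inj₂ (x~x′ , i<i′)) → at-mono _ _ (representative-cong x~x′) i<i′ }
    ; to-refl = λ {a} {b} → toL-reflects a b }

mainTheorem1 : ExcludedMiddle 0ℓ →
    ((L : OrdStr) → IsLinOrd L → Countable L → IsModelT (Φ L))
    × ((K : TStr) → IsModelT K → Countable (TStr.ord K) → IsLinOrd (Ψ K) × Countable (Ψ K))
    × ((L : OrdStr) → IsLinOrd L → Countable L → Ψ (Φ L) ≅ L)
    × ((K : TStr) → IsModelT K → Countable (TStr.ord K) → Φ (Ψ K) ≅ₜ K)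
mainTheorem1 em =
    (λ L lin _ → Condensation.Classification.Φ-model lin em)
  , (λ K M countable → Ψ-linear K (IsModelT.linear M) , Ψ-countable K countable)
  , (λ L lin countable → Reconstruction.Ψ[Φ]≅ em lin countable)
  , (λ K M _ → SumOf.Φ[Ψ]≅ em M)
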